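{- Let $S_1,\ldots,S_m$ (with $m \ge 2$) be an $\alpha$-balanced solution of a Bin Packing instance with $n$ items, for some $0 < \alpha < \frac{1}{4m}$. Let $k \in [m]$ be a bin with $|S_k|$ maximum and $k' \in [m]\setminus\{k\}$ a bin with $|S_{k'}|$ maximum among the remaining bins. Then either 1. $|S_k|, |S_{k'}| \in [(1/2 - \alpha)n, (1/2+\alpha)n]$, or 2. $|S_j| \le (\frac12 - \frac{1}{4m})n$ for all bins $j \in [m]$.
   Context: Bin Packing instance: item weights $w(1),\ldots,w(n) \in \mathbb{N}$, capacities $c_1,\ldots,c_m$; a solution is a partition $S_1,\ldots,S_m$ of $[n]$ with $\sum_{i\in S_j} w(i) \le c_j$ for all $j$. A solution is $\alpha$-balanced if for every permutation $\pi$ of $[m]$ there is $b \in [m]$ with $\sum_{j=1}^b |S_{\pi(j)}| \in [n/2 - \alpha n, n/2 + \alpha n]$.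
   Formalization: The balance parameter α ranges over the rationals. -}

module Defs where

open import Data.Nat using (ℕ; zero; suc; _≤_) renaming (_*_ to _*ℕ_)
open import Data.Fin using (Fin; toℕ; _≟_)
open import Data.List using (List; length; filter; map; take; allFin)
open import Data.Nat.ListAction using (sum)
open import Data.Integer using (+_)
open import Data.Rational using (ℚ; 0ℚ; _/_; _-_; _+_; _*_; ½) renaming (_≤_ to _≤ℚ_)
open import Data.Product using (Σ; _×_)
open import Data.Fin.Permutation using (Permutation′; _⟨$⟩ʳ_)

toℚ : ℕ → ℚ
toℚ k = (+ k) / 1

-- 1/(4m) as a rational (for m ≥ 1; the value at m = 0 is irrelevant since m ≥ 2)
inv4m : ℕ → ℚ
inv4m zero = 0ℚ
inv4m (suc k) = (+ 1) / (4 *ℕ suc k)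

-- A solution S_1..S_m (a partition of [n] into m labelled, possibly empty parts)
-- is represented by the assignment σ : Fin n → Fin m, with S_j = σ⁻¹(j).
Assignment : ℕ → ℕ → Set
Assignment n m = Fin n → Fin m

bin : ∀ {n m} → Assignment n m → Fin m → List (Fin n)
bin {n} σ j = filter (λ i → σ i ≟ j) (allFin n)

binSize : ∀ {n m} → Assignment n m → Fin m → ℕ
binSize σ j = length (bin σ j)

binWeight : ∀ {n m} → (Fin n → ℕ) → Assignment n m → Fin m → ℕ
binWeight w σ j = sum (map w (bin σ j))

IsSolution : ∀ {n m} → (Fin n → ℕ) → (Fin m → ℕ) → Assignment n m → Set
IsSolution w c σ = ∀ j → binWeight w σ j ≤ c j

InBalancedRange : ℚ → ℕ → ℕ → Set
InBalancedRange α n x = ((½ - α) * toℚ n ≤ℚ toℚ x) × (toℚ x ≤ℚ (½ + α) * toℚ n)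

-- Σ_{t=1}^{b} |S_{π(t)}|, for b = 1 .. m (b given as Fin m, representing toℕ b + 1)
prefixSize : ∀ {n m} → Assignment n m → Permutation′ m → Fin m → ℕ
prefixSize {n} {m} σ π b = sum (take (suc (toℕ b)) (map (λ t → binSize σ (π ⟨$⟩ʳ t)) (allFin m)))

Balanced : ∀ {n m} → ℚ → Assignment n m → Set
Balanced {n} {m} α σ = (π : Permutation′ m) → Σ (Fin m) (λ b → InBalancedRange α n (prefixSize σ π b))

module Submission where

-- If no bin exceeds (½ − 1/4m)n we are in the second case, so let the largest bin have A > (½ − 1/4m)n
-- items.  Every prefix of an order that starts with S_k contains S_k, hence A ≤ (½ + α)n.  If the
-- second largest bin has B ≥ (½ − α)n we are in the first case.  Otherwise, in an order starting
-- with S_k′ and then S_k, the prefix of length one is too small, so a balanced prefix contains both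
-- bins and A + B ≤ (½ + α)n.  Since all bins other than S_k have at most B items, n ≤ A + (m − 1)B,
-- and then  m(½ + α)n ≥ A + (m − 1)(A + B) ≥ n + (m − 1)A > n + (m − 1)(½ − 1/4m)n = m(½ + 1/4m)n + n/4m,
-- which contradicts α < 1/4m.

open import Defs
open import Data.Bool using (if_then_else_)
open import Data.Empty using (⊥; ⊥-elim)
open import Data.Fin using (Fin; zero; suc; punchIn; _≟_)
open import Data.Fin.Patterns using (0F; 1F)
open import Data.Fin.Permutation using (Permutation′; _⟨$⟩ʳ_; _∘ₚ_; transpose)
import Data.Fin.Permutation.Components as PC
open import Data.Fin.Properties using (punchInᵢ≢i; all?; ¬∀⟶∃¬)
open import Data.Integer as ℤ using (+_)
import Data.Integer.Properties as ℤ
open import Data.List using (List; []; _∷_; length; filter; allFin)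
open import Data.List.Properties using (length-tabulate)
open import Data.Nat as ℕ using (ℕ; zero; suc; z≤n; s≤s; _≥_) renaming (_≤_ to _≤ℕ_)
open import Data.Nat.Coprimality using (1-coprimeTo)
import Data.Nat.Coprimality as Coprime
import Data.Nat.Properties as ℕ
open import Algebra.Properties.CommutativeMonoid.Sum ℕ.+-0-commutativeMonoid
  using (sum; sum-cong-≗; sum-replicate-zero; sum-remove; ∑-distrib-+)
open import Data.Product using (Σ; _×_; _,_)
open import Data.Rational
  using (ℚ; _<_; _≤_; _+_; _-_; _*_; _/_; ½; 0ℚ; 1ℚ; toℚᵘ; NonNegative; Positive)
import Data.Rational.Properties as ℚ
open import Data.Rational.Solver using (module +-*-Solver)
import Data.Rational.Unnormalised as ℚᵘ
import Data.Rational.Unnormalised.Properties as ℚᵘ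
open import Data.Sum using (_⊎_; inj₁; inj₂; [_,_]′)
open import Relation.Binary.PropositionalEquality
  using (_≡_; refl; sym; trans; cong; cong₂; subst; subst₂; module ≡-Reasoning)
open import Relation.Nullary using (¬_; yes; no; does)
open import Relation.Nullary.Decidable using (toSum; decidable-stable)

sum-≤-* : ∀ {m} (f : Fin m → ℕ) {B} → (∀ j → f j ≤ℕ B) → sum f ≤ℕ m ℕ.* B
sum-≤-* {zero}  f f≤B = z≤n
sum-≤-* {suc m} f f≤B = ℕ.+-mono-≤ (f≤B zero) (sum-≤-* (λ j → f (suc j)) (λ j → f≤B (suc j)))

sum-≤-except : ∀ {m} (f : Fin (suc m) → ℕ) (k : Fin (suc m)) {B} →
               (∀ j → ¬ (j ≡ k) → f j ≤ℕ B) → sum f ≤ℕ f k ℕ.+ m ℕ.* B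
sum-≤-except f k f≤B = ℕ.≤-trans (ℕ.≤-reflexive (sum-remove {i = k} f))
  (ℕ.+-monoʳ-≤ (f k) (sum-≤-* (λ j → f (punchIn k j)) (λ j → f≤B (punchIn k j) (punchInᵢ≢i k j))))

indicator : ∀ {m} → Fin m → Fin m → ℕ
indicator y j = if does (y ≟ j) then 1 else 0

sum-indicator : ∀ {m} (y : Fin m) → sum (indicator y) ≡ 1
sum-indicator {suc m} zero    = cong suc (sum-replicate-zero m)
sum-indicator         (suc y) = sum-indicator y

module _ {n m : ℕ} (σ : Assignment n m) where

  private
    count : Fin m → List (Fin n) → ℕ
    count j xs = length (filter (λ i → σ i ≟ j) xs)

    count-∷ : ∀ x xs j → count j (x ∷ xs) ≡ indicator (σ x) j ℕ.+ count j xs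
    count-∷ x xs j with σ x ≟ j
    ... | yes _ = refl
    ... | no  _ = refl

    sum-count : ∀ xs → sum (λ j → count j xs) ≡ length xs
    sum-count []       = sum-replicate-zero m
    sum-count (x ∷ xs) = begin
      sum (λ j → count j (x ∷ xs))                      ≡⟨ sum-cong-≗ (count-∷ x xs) ⟩
      sum (λ j → indicator (σ x) j ℕ.+ count j xs)      ≡⟨ ∑-distrib-+ (indicator (σ x)) _ ⟩
      sum (indicator (σ x)) ℕ.+ sum (λ j → count j xs)  ≡⟨ cong₂ ℕ._+_ (sum-indicator (σ x)) (sum-count xs) ⟩
      suc (length xs)                                   ∎
      where open ≡-Reasoning

  sum-binSize : sum (binSize σ) ≡ n
  sum-binSize = trans (sum-count (allFin n)) (length-tabulate (λ i → i))

n≤binSize+others : ∀ {n q} (σ : Assignment n (suc q)) (k : Fin (suc q)) {B} →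
                   (∀ j → ¬ (j ≡ k) → binSize σ j ≤ℕ B) → n ≤ℕ binSize σ k ℕ.+ q ℕ.* B
n≤binSize+others {q = q} σ k {B} others≤B =
  subst (_≤ℕ binSize σ k ℕ.+ q ℕ.* B) (sum-binSize σ) (sum-≤-except (binSize σ) k others≤B)

transpose-matchˡ : ∀ {m} (i j : Fin m) → PC.transpose i j i ≡ j
transpose-matchˡ i j with i ≟ i
... | yes _   = refl
... | no  i≢i = ⊥-elim (i≢i refl)

transpose-fix : ∀ {m} {i j k : Fin m} → ¬ (k ≡ i) → ¬ (k ≡ j) → PC.transpose i j k ≡ k
transpose-fix {i = i} {j} {k} k≢i k≢j with k ≟ i
... | yes k≡i = ⊥-elim (k≢i k≡i)
... | no  _ with k ≟ j
...   | yes k≡j = ⊥-elim (k≢j k≡j)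
...   | no  _   = refl

module _ {p : ℕ} (a b : Fin (suc (suc p))) where

  private
    b′ : Fin (suc (suc p))
    b′ = PC.transpose a 0F b

  -- π₁ ∘ₚ π₂ applies π₁ first: 0F ↦ 0F ↦ a and 1F ↦ b′ ↦ b.
  frontPair : Permutation′ (suc (suc p))
  frontPair = transpose 1F b′ ∘ₚ transpose 0F a

  frontPair-0F : ¬ (a ≡ b) → frontPair ⟨$⟩ʳ 0F ≡ a
  frontPair-0F a≢b =
    trans (cong (PC.transpose 0F a) (transpose-fix {i = 1F} (λ ()) 0≢b′)) (transpose-matchˡ 0F a)
    where
    0≢b′ : ¬ (0F ≡ b′)
    0≢b′ 0≡b′ = a≢b (begin
      a                     ≡⟨ transpose-matchˡ 0F a ⟨
      PC.transpose 0F a 0F  ≡⟨ cong (PC.transpose 0F a) 0≡b′ ⟩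
      PC.transpose 0F a b′  ≡⟨ PC.transpose-inverse 0F a ⟩
      b                     ∎)
      where open ≡-Reasoning

  frontPair-1F : frontPair ⟨$⟩ʳ 1F ≡ b
  frontPair-1F = trans (cong (PC.transpose 0F a) (transpose-matchˡ 1F b′)) (PC.transpose-inverse 0F a)

module _ {n p : ℕ} (σ : Assignment n (suc (suc p))) (π : Permutation′ (suc (suc p))) where

  private
    size : Fin (suc (suc p)) → ℕ
    size t = binSize σ (π ⟨$⟩ʳ t)

  prefixSize-0F : prefixSize σ π 0F ≡ size 0F
  prefixSize-0F = ℕ.+-identityʳ (size 0F)

  prefixSize-suc : ∀ b → size 0F ℕ.+ size 1F ≤ℕ prefixSize σ π (suc b)
  prefixSize-suc b = ℕ.+-monoʳ-≤ (size 0F) (ℕ.m≤m+n (size 1F) _)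

  prefixSize-≥-head : ∀ b → size 0F ≤ℕ prefixSize σ π b
  prefixSize-≥-head zero    = ℕ.m≤m+n _ _
  prefixSize-≥-head (suc b) = ℕ.≤-trans (ℕ.m≤m+n _ _) (prefixSize-suc b)

toℚᵘ-toℚ : ∀ k → toℚᵘ (toℚ k) ≡ ℚᵘ.mkℚᵘ (+ k) 0
toℚᵘ-toℚ k = cong toℚᵘ (ℚ.normalize-coprime (Coprime.sym (1-coprimeTo k)))

toℚ-mono-≤ : ∀ {a b} → a ≤ℕ b → toℚ a ≤ toℚ b
toℚ-mono-≤ {a} {b} a≤b = ℚ.toℚᵘ-cancel-≤ (subst₂ ℚᵘ._≤_ (sym (toℚᵘ-toℚ a)) (sym (toℚᵘ-toℚ b))
  (ℚᵘ.*≤* (subst₂ ℤ._≤_ (sym (ℤ.*-identityʳ (+ a))) (sym (ℤ.*-identityʳ (+ b))) (ℤ.+≤+ a≤b))))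

toℚ-homo-+ : ∀ a b → toℚ (a ℕ.+ b) ≡ toℚ a + toℚ b
toℚ-homo-+ a b =
  ℚ.toℚᵘ-injective (ℚᵘ.≃-trans (ℚᵘ.≃-reflexive eq) (ℚᵘ.≃-sym (ℚ.toℚᵘ-homo-+ (toℚ a) (toℚ b))))
  where
  eq : toℚᵘ (toℚ (a ℕ.+ b)) ≡ toℚᵘ (toℚ a) ℚᵘ.+ toℚᵘ (toℚ b)
  eq rewrite toℚᵘ-toℚ a | toℚᵘ-toℚ b | toℚᵘ-toℚ (a ℕ.+ b)
           | ℤ.*-identityʳ (+ a) | ℤ.*-identityʳ (+ b) = cong (λ z → ℚᵘ.mkℚᵘ z 0) (ℤ.pos-+ a b)

toℚ-homo-* : ∀ a b → toℚ (a ℕ.* b) ≡ toℚ a * toℚ b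
toℚ-homo-* a b =
  ℚ.toℚᵘ-injective (ℚᵘ.≃-trans (ℚᵘ.≃-reflexive eq) (ℚᵘ.≃-sym (ℚ.toℚᵘ-homo-* (toℚ a) (toℚ b))))
  where
  eq : toℚᵘ (toℚ (a ℕ.* b)) ≡ toℚᵘ (toℚ a) ℚᵘ.* toℚᵘ (toℚ b)
  eq rewrite toℚᵘ-toℚ a | toℚᵘ-toℚ b | toℚᵘ-toℚ (a ℕ.* b) = cong (λ z → ℚᵘ.mkℚᵘ z 0) (ℤ.pos-* a b)

¼ : ℚ
¼ = + 1 / 4

toℚ*inv4m : ∀ k → toℚ (suc k) * inv4m (suc k) ≡ ¼
toℚ*inv4m k = ℚ.toℚᵘ-injective (ℚᵘ.≃-trans (ℚ.toℚᵘ-homo-* (toℚ (suc k)) (inv4m (suc k))) eq)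
  where
  toℚᵘ-inv4m : toℚᵘ (inv4m (suc k)) ≡ ℚᵘ.mkℚᵘ (+ 1) (ℕ.pred (4 ℕ.* suc k))
  toℚᵘ-inv4m = cong toℚᵘ (ℚ.normalize-coprime (1-coprimeTo _))

  eq : toℚᵘ (toℚ (suc k)) ℚᵘ.* toℚᵘ (inv4m (suc k)) ℚᵘ.≃ toℚᵘ ¼
  eq rewrite toℚᵘ-toℚ (suc k) | toℚᵘ-inv4m = ℚᵘ.*≡* (begin
    + suc k ℤ.* + 1 ℤ.* + 4          ≡⟨ cong (ℤ._* + 4) (ℤ.*-identityʳ (+ suc k)) ⟩
    + suc k ℤ.* + 4                  ≡⟨ ℤ.pos-* (suc k) 4 ⟨
    + (suc k ℕ.* 4)                  ≡⟨ cong +_ (ℕ.*-comm (suc k) 4) ⟩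
    + (4 ℕ.* suc k)                  ≡⟨ cong +_ (ℕ.*-identityˡ _) ⟨
    + (1 ℕ.* (4 ℕ.* suc k))          ≡⟨ ℤ.*-identityˡ _ ⟨
    + 1 ℤ.* + (1 ℕ.* (4 ℕ.* suc k))  ∎)
    where open ≡-Reasoning

module _ where
  open +-*-Solver

  split-identity : ∀ N q ι → (1ℚ + q) * ι ≡ ¼ →
                   N + q * ((½ - ι) * N) ≡ (1ℚ + q) * ((½ + ι) * N) + ι * N
  split-identity N q ι m*ι≡¼ = begin
    N + q * ((½ - ι) * N)                                 ≡⟨ with-defect N q ι ⟩
    M[½+ι]N + ι * N + N * (½ - (1ℚ + q) * ι - (1ℚ + q) * ι)  ≡⟨ cong (λ x → M[½+ι]N + ι * N + N * (½ - x - x)) m*ι≡¼ ⟩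
    M[½+ι]N + ι * N + N * 0ℚ                              ≡⟨ cong (λ x → M[½+ι]N + ι * N + x) (ℚ.*-zeroʳ N) ⟩
    M[½+ι]N + ι * N + 0ℚ                                  ≡⟨ ℚ.+-identityʳ _ ⟩
    M[½+ι]N + ι * N                                       ∎
    where
    open ≡-Reasoning
    M[½+ι]N : ℚ
    M[½+ι]N = (1ℚ + q) * ((½ + ι) * N)
    with-defect : ∀ N q ι →
      N + q * ((½ - ι) * N) ≡ (1ℚ + q) * ((½ + ι) * N) + ι * N + N * (½ - (1ℚ + q) * ι - (1ℚ + q) * ι)
    with-defect = solve 3 (λ N q ι →
      N :+ q :* ((con ½ :- ι) :* N) :=
      (con 1ℚ :+ q) :* ((con ½ :+ ι) :* N) :+ ι :* N :+ N :* (con ½ :- (con 1ℚ :+ q) :* ι :- (con 1ℚ :+ q) :* ι)) refl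

  two-largest-overflow : ∀ {N A B α ι q} → .{{_ : NonNegative N}} → .{{_ : Positive q}} → .{{_ : NonNegative ι}} →
    (1ℚ + q) * ι ≡ ¼ → α < ι →
    (½ - ι) * N < A → A ≤ (½ + α) * N → A + B ≤ (½ + α) * N → N ≤ A + q * B → ⊥
  two-largest-overflow {N} {A} {B} {α} {ι} {q} m*ι≡¼ α<ι lower<A A≤U A+B≤U N≤A+qB = ℚ.<-irrefl refl (begin-strict
    (1ℚ + q) * U                      ≤⟨ ℚ.*-monoˡ-≤-nonNeg (1ℚ + q) (ℚ.*-monoʳ-≤-nonNeg N (ℚ.+-monoʳ-≤ ½ (ℚ.<⇒≤ α<ι))) ⟩
    (1ℚ + q) * ((½ + ι) * N)          ≤⟨ x≤x+nonNeg _ (ι * N) ⟩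
    (1ℚ + q) * ((½ + ι) * N) + ι * N  ≡⟨ split-identity N q ι m*ι≡¼ ⟨
    N + q * ((½ - ι) * N)             <⟨ ℚ.+-monoʳ-< N (ℚ.*-monoʳ-<-pos q lower<A) ⟩
    N + q * A                         ≤⟨ ℚ.+-monoˡ-≤ (q * A) N≤A+qB ⟩
    A + q * B + q * A                 ≡⟨ solve 3 (λ A B q → A :+ q :* B :+ q :* A := A :+ q :* (A :+ B)) refl A B q ⟩
    A + q * (A + B)                   ≤⟨ ℚ.+-mono-≤ A≤U (ℚ.*-monoˡ-≤-nonNeg q {{ℚ.pos⇒nonNeg q}} A+B≤U) ⟩
    U + q * U                         ≡⟨ solve 2 (λ U q → U :+ q :* U := (con 1ℚ :+ q) :* U) refl U q ⟩
    (1ℚ + q) * U                      ∎)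
    where
    open ℚ.≤-Reasoning
    U : ℚ
    U = (½ + α) * N
    instance
      1+q-nonNeg : NonNegative (1ℚ + q)
      1+q-nonNeg = ℚ.nonNeg+nonNeg⇒nonNeg 1ℚ q {{ℚ.pos⇒nonNeg q}}
      ιN-nonNeg : NonNegative (ι * N)
      ιN-nonNeg = ℚ.nonNeg*nonNeg⇒nonNeg ι N
    x≤x+nonNeg : ∀ x y → .{{NonNegative y}} → x ≤ x + y
    x≤x+nonNeg x y = subst (_≤ x + y) (ℚ.+-identityʳ x) (ℚ.+-monoʳ-≤ x (ℚ.nonNegative⁻¹ y))

module BalancedSolution {n p : ℕ} {α : ℚ} {σ : Assignment n (suc (suc p))} (balanced : Balanced α σ) where

  binSize≤upper : ∀ a → toℚ (binSize σ a) ≤ (½ + α) * toℚ n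
  binSize≤upper a =
    let b , _ , prefix≤upper = balanced (transpose 0F a)
    in  ℚ.≤-trans (toℚ-mono-≤ (prefixSize-≥-head σ (transpose 0F a) b)) prefix≤upper

  pair≤upper : ∀ {a b} → ¬ (b ≡ a) → ¬ ((½ - α) * toℚ n ≤ toℚ (binSize σ b)) →
               toℚ (binSize σ a ℕ.+ binSize σ b) ≤ (½ + α) * toℚ n
  pair≤upper {a} {b} b≢a b-small = fromBalancedPrefix (balanced π)
    where
    π : Permutation′ (suc (suc p))
    π = frontPair b a

    fromBalancedPrefix : Σ (Fin (suc (suc p))) (λ t → InBalancedRange α n (prefixSize σ π t)) →
                         toℚ (binSize σ a ℕ.+ binSize σ b) ≤ (½ + α) * toℚ n
    fromBalancedPrefix (zero  , lower≤prefix , _) =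
      ⊥-elim (b-small (subst (λ x → (½ - α) * toℚ n ≤ toℚ x) prefix≡b lower≤prefix))
      where
      prefix≡b : prefixSize σ π 0F ≡ binSize σ b
      prefix≡b = trans (prefixSize-0F σ π) (cong (binSize σ) (frontPair-0F b a b≢a))
    fromBalancedPrefix (suc t , _ , prefix≤upper) = ℚ.≤-trans (toℚ-mono-≤ pair≤prefix) prefix≤upper
      where
      pair≤prefix : binSize σ a ℕ.+ binSize σ b ≤ℕ prefixSize σ π (suc t)
      pair≤prefix = subst (_≤ℕ prefixSize σ π (suc t))
        (trans (cong₂ ℕ._+_ (cong (binSize σ) (frontPair-0F b a b≢a)) (cong (binSize σ) (frontPair-1F b a)))
               (ℕ.+-comm (binSize σ b) (binSize σ a)))
        (prefixSize-suc σ π t)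

  module _ {k k′ : Fin (suc (suc p))} (k-max : ∀ j → binSize σ j ≤ℕ binSize σ k) where

    private
      m : ℕ
      m = suc (suc p)
      A B : ℚ
      A = toℚ (binSize σ k)
      B = toℚ (binSize σ k′)

    both-in-range : (½ - α) * toℚ n ≤ B →
                    InBalancedRange α n (binSize σ k) × InBalancedRange α n (binSize σ k′)
    both-in-range lower≤B =
      (ℚ.≤-trans lower≤B B≤A , binSize≤upper k) , (lower≤B , ℚ.≤-trans B≤A (binSize≤upper k))
      where
      B≤A : B ≤ A
      B≤A = toℚ-mono-≤ (k-max k′)

    second-largest-large : α < inv4m m → ¬ (k′ ≡ k) → (∀ j → ¬ (j ≡ k) → binSize σ j ≤ℕ binSize σ k′) →
                           ¬ (∀ j → toℚ (binSize σ j) ≤ (½ - inv4m m) * toℚ n) →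
                           (½ - α) * toℚ n ≤ B
    second-largest-large α<ι k′≢k k′-max some-large =
      decidable-stable ((½ - α) * toℚ n ℚ.≤? B) λ B-small →
        two-largest-overflow {toℚ n} {A} {B} {α} {inv4m m} {toℚ (suc p)}
          {{ℚ.normalize-nonNeg n 1}} {{ℚ.normalize-pos (suc p) 1}} {{ℚ.normalize-nonNeg 1 (4 ℕ.* m)}}
          m*ι≡¼ α<ι lower<A (binSize≤upper k) (A+B≤upper B-small) n≤A+qB
      where
      m*ι≡¼ : (1ℚ + toℚ (suc p)) * inv4m m ≡ ¼
      m*ι≡¼ = trans (cong (_* inv4m m) (sym (toℚ-homo-+ 1 (suc p)))) (toℚ*inv4m (suc p))

      lower<A : (½ - inv4m m) * toℚ n < A
      lower<A =
        let j , j-large = ¬∀⟶∃¬ m (λ j → toℚ (binSize σ j) ≤ (½ - inv4m m) * toℚ n)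
                                  (λ j → toℚ (binSize σ j) ℚ.≤? (½ - inv4m m) * toℚ n) some-large
        in  ℚ.<-≤-trans (ℚ.≰⇒> j-large) (toℚ-mono-≤ (k-max j))

      A+B≤upper : ¬ ((½ - α) * toℚ n ≤ B) → A + B ≤ (½ + α) * toℚ n
      A+B≤upper B-small =
        subst (_≤ (½ + α) * toℚ n) (toℚ-homo-+ (binSize σ k) (binSize σ k′)) (pair≤upper k′≢k B-small)

      n≤A+qB : toℚ n ≤ A + toℚ (suc p) * B
      n≤A+qB = subst (toℚ n ≤_)
        (trans (toℚ-homo-+ (binSize σ k) (suc p ℕ.* binSize σ k′))
               (cong (λ x → A + x) (toℚ-homo-* (suc p) (binSize σ k′))))
        (toℚ-mono-≤ (n≤binSize+others σ k k′-max))

mainTheorem9 : (n m : ℕ) → m ≥ 2 → (w : Fin n → ℕ) → (c : Fin m → ℕ) →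
    (σ : Assignment n m) → IsSolution w c σ →
    (α : ℚ) → 0ℚ < α → α < inv4m m →
    Balanced α σ →
    (k : Fin m) → (∀ j → binSize σ j ≤ℕ binSize σ k) →
    (k′ : Fin m) → ¬ (k′ ≡ k) → (∀ j → ¬ (j ≡ k) → binSize σ j ≤ℕ binSize σ k′) →
    (InBalancedRange α n (binSize σ k) × InBalancedRange α n (binSize σ k′))
    ⊎ (∀ j → toℚ (binSize σ j) ≤ (½ - inv4m m) * toℚ n)
mainTheorem9 n (suc (suc p)) (s≤s (s≤s z≤n)) _ _ σ _ α _ α<ι balanced k k-max k′ k′≢k k′-max =
  [ inj₂ , (λ some-large → inj₁ (both-in-range k-max (second-largest-large k-max α<ι k′≢k k′-max some-large))) ]′
    (toSum (all? (λ j → toℚ (binSize σ j) ℚ.≤? (½ - inv4m (suc (suc p))) * toℚ n)))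
  where
  open BalancedSolution {α = α} {σ} balanced
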